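{- Let $\Gamma$ be a finite graph with vertex set $V$, let $A=\mathrm{Aut}(D(\Gamma))$, and let $B$ be the subgroup of $A$ stabilizing $V^+=V\times\{0\}$ setwise. Then: (a) if $\Gamma$ is connected and non-bipartite, then $D(\Gamma)$ is connected and $A=B\rtimes C_2$; (b) if $\Gamma$ is twin-free, then $B^+\cong B\cong B^-$.
   Context: Graphs may have loops. $D(\Gamma)$ is the graph on $V\times\{0,1\}$ with $(u,x)\sim(v,y)$ iff $u\sim v$ in $\Gamma$ and $x\ne y$; write $V^+=V\times\{0\}$, $V^-=V\times\{1\}$. For $\varepsilon\in\{+,-\}$, $B^\varepsilon$ denotes the permutation group on $V^\varepsilon$ induced by $B$ (the image of the restriction homomorphism $B\to\mathrm{Sym}(V^\varepsilon)$). A graph is twin-free if no two distinct vertices have the same neighbourhood. -}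

module Defs where

open import Data.Nat using (ℕ)
open import Data.Fin using (Fin)
open import Data.Bool using (Bool; true; false; _∧_; _xor_)
open import Data.Product using (Σ; ∃; _×_; _,_; proj₁; proj₂)
open import Data.Sum using (_⊎_)
open import Relation.Nullary using (¬_)
open import Relation.Binary.PropositionalEquality using (_≡_; _≢_)
open import Function.Bundles using (_↔_; Inverse; _⇔_)
open import Function.Construct.Composition using (_↔-∘_)
open import Function.Construct.Identity using (↔-id)
open import Function.Construct.Symmetry using (↔-sym)

record Graph (n : ℕ) : Set where
  field
    adj : Fin n → Fin n → Bool
    adj-sym : ∀ u v → adj u v ≡ adj v u
open Graph public

Rel₂ : Set → Set
Rel₂ X = X → X → Bool

Perm : Set → Set
Perm X = X ↔ X

_∘ₚ_ : ∀ {X} → Perm X → Perm X → Perm X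
a ∘ₚ b = a ↔-∘ b

_⁻¹ₚ : ∀ {X} → Perm X → Perm X
a ⁻¹ₚ = ↔-sym a

idₚ : ∀ {X} → Perm X
idₚ = ↔-id _

_≈ₚ_ : ∀ {X} → Perm X → Perm X → Set
a ≈ₚ b = ∀ x → Inverse.to a x ≡ Inverse.to b x

IsAut : ∀ {X} → Rel₂ X → Perm X → Set
IsAut R σ = ∀ u v → R (Inverse.to σ u) (Inverse.to σ v) ≡ R u v

data Reach {X : Set} (R : Rel₂ X) : X → X → Set where
  here : ∀ {u} → Reach R u u
  step : ∀ {u v w} → R u v ≡ true → Reach R v w → Reach R u w

Connected : ∀ {X} → Rel₂ X → Set
Connected {X} R = (u v : X) → Reach R u v

-- bipartite: proper 2-colouring (a loop prevents this)
Bipartite : ∀ {X} → Rel₂ X → Set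
Bipartite {X} R = Σ (X → Bool) λ c → ∀ u v → R u v ≡ true → c u ≢ c v

TwinFree : ∀ {X} → Rel₂ X → Set
TwinFree {X} R = ∀ u v → (∀ w → R u w ≡ R v w) → u ≡ v

-- The canonical double cover D(Γ) on V × {0,1}, with 0 = false, 1 = true

DV : ℕ → Set
DV n = Fin n × Bool

Dadj : ∀ {n} → Graph n → Rel₂ (DV n)
Dadj Γ (u , x) (v , y) = adj Γ u v ∧ (x xor y)

AutD : ∀ {n} → Graph n → Perm (DV n) → Set
AutD Γ σ = IsAut (Dadj Γ) σ

StabD : ∀ {n} → Graph n → Perm (DV n) → Set
StabD Γ σ = AutD Γ σ ×
  (∀ p → (proj₂ p ≡ false) ⇔ (proj₂ (Inverse.to σ p) ≡ false))

-- B^ε : the permutation group induced by B on V^ε, where V^ε = V × {ε}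
-- is identified with V via v ↦ (v , ε)   (ε = false for +, true for −)
Induced : ∀ {n} → Graph n → Bool → Perm (Fin n) → Set
Induced {n} Γ ε π = Σ (Perm (DV n)) λ σ → StabD Γ σ ×
  (∀ v → Inverse.to σ (v , ε) ≡ (Inverse.to π v , ε))

BPlus BMinus : ∀ {n} → Graph n → Perm (Fin n) → Set
BPlus Γ = Induced Γ false
BMinus Γ = Induced Γ true

-- Abstract isomorphism of permutation groups G ≤ Sym(X), H ≤ Sym(Y)
-- (given as predicates; group law = composition, equality = ≈ₚ).

record GroupIso {X Y : Set} (G : Perm X → Set) (H : Perm Y → Set) : Set where
  field
    f      : Σ (Perm X) G → Σ (Perm Y) H
    f-cong : ∀ g g' → proj₁ g ≈ₚ proj₁ g' → proj₁ (f g) ≈ₚ proj₁ (f g')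
    f-hom  : ∀ g g' k → proj₁ k ≈ₚ (proj₁ g ∘ₚ proj₁ g') →
             proj₁ (f k) ≈ₚ (proj₁ (f g) ∘ₚ proj₁ (f g'))
    f-inj  : ∀ g g' → proj₁ (f g) ≈ₚ proj₁ (f g') → proj₁ g ≈ₚ proj₁ g'
    f-surj : (h : Σ (Perm Y) H) → ∃ λ (g : Σ (Perm X) G) → proj₁ (f g) ≈ₚ proj₁ h

_≅_ : {X Y : Set} → (Perm X → Set) → (Perm Y → Set) → Set
G ≅ H = GroupIso G H

-- Internal semidirect product A = B ⋊ C₂ (for subgroups A, B of Sym(X)):
-- B ⊆ A, B ⊴ A, and there is τ ∈ A with τ² = 1, τ ∉ B (so ⟨τ⟩ ≅ C₂ and
-- B ∩ ⟨τ⟩ = 1), and A = B⟨τ⟩.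

IsSemidirectC₂ : ∀ {X} → (A B : Perm X → Set) → Set
IsSemidirectC₂ {X} A B =
  (∀ b → B b → A b) ×
  (∀ a b → A a → B b → B (a ∘ₚ (b ∘ₚ (a ⁻¹ₚ)))) ×
  Σ (Perm X) λ τ → A τ × ((τ ∘ₚ τ) ≈ₚ idₚ) × ¬ B τ ×
    (∀ a → A a → B a ⊎ B (a ∘ₚ τ))

{-# OPTIONS --safe #-}
-- A walk of Γ lifts to D(Γ), changing layer at every step.  If Γ is connected,
-- colour each vertex by the parity of a fixed walk to it from a base vertex u;
-- when Γ is not bipartite this colouring has a monochromatic edge, and the walk
-- through that edge is an odd closed walk at u, which lifts to a walk from
-- (u,0) to (u,1).  Hence D(Γ) is connected.  Every edge of D(Γ) changes layer,
-- so for an automorphism a the bit "a moves p to the other layer" is constant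
-- along edges, hence constant: a either preserves both layers (a ∈ B) or swaps
-- them (a τ ∈ B for the layer swap τ), and A = B ⋊ ⟨τ⟩.
--
-- For (b), an element σ of B is determined by its action on one layer V^ε:
-- σ(v,1-ε) is the vertex of V^(1-ε) adjacent to exactly the σ-images of the
-- neighbours of (v,1-ε) in V^ε, and twin-freeness makes that vertex unique.
-- So restriction B → B^ε, surjective by definition of B^ε, is an isomorphism.
module Submission where

open import Defs
open import Data.Nat using (ℕ)
open import Data.Fin using (Fin)
open import Data.Fin.Properties using (any?)
open import Data.Bool using (Bool; true; false; _∧_; _xor_; not)
open import Data.Bool.Properties as Boolₚ
  using (∧-identityʳ; not-involutive; xor-assoc; xor-comm; xor-same; xor-identityʳ;
         xor-inverseˡ; xor-inverseʳ; not-distribˡ-xor; not-distribʳ-xor)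
open import Data.Product using (Σ; ∃; ∃₂; _×_; _,_; proj₁; proj₂)
open import Data.Sum using (_⊎_; inj₁; inj₂)
open import Data.Empty using (⊥-elim)
open import Function using (const)
open import Function.Bundles using (Inverse; Equivalence; _⇔_; mk⇔; mk↔ₛ′)
open import Relation.Nullary using (¬_; yes; no)
open import Relation.Nullary.Decidable using (_×-dec_)
open import Relation.Binary.PropositionalEquality

open Inverse using (to; from; strictlyInverseˡ; strictlyInverseʳ)

xor-solve : ∀ x y → y ≡ (x xor y) xor x
xor-solve false false = refl
xor-solve false true  = refl
xor-solve true  false = refl
xor-solve true  true  = refl

not-xor-not : ∀ x y → not x xor not y ≡ x xor y
not-xor-not false y = not-involutive y
not-xor-not true  y = refl

≡false⇔⇒≡ : ∀ {x y} → (x ≡ false ⇔ y ≡ false) → y ≡ x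
≡false⇔⇒≡ {false} x⇔y = Equivalence.to x⇔y refl
≡false⇔⇒≡ {true} {false} x⇔y = sym (Equivalence.from x⇔y refl)
≡false⇔⇒≡ {true} {true}  x⇔y = refl

module _ {X : Set} {R : Rel₂ X} where

  aut-∘ : ∀ {a b} → IsAut R a → IsAut R b → IsAut R (a ∘ₚ b)
  aut-∘ {b = b} a-aut b-aut u v = trans (a-aut (to b u) (to b v)) (b-aut u v)

  aut-⁻¹ : ∀ {a} → IsAut R a → IsAut R (a ⁻¹ₚ)
  aut-⁻¹ {a} a-aut u v = begin
    R (from a u) (from a v)               ≡⟨ a-aut (from a u) (from a v) ⟨
    R (to a (from a u)) (to a (from a v)) ≡⟨ cong₂ R (strictlyInverseˡ a u) (strictlyInverseˡ a v) ⟩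
    R u v                                 ∎
    where open ≡-Reasoning

  reach-trans : ∀ {u v w} → Reach R u v → Reach R v w → Reach R u w
  reach-trans here       q = q
  reach-trans (step e p) q = step e (reach-trans p q)

  reach-sym : (∀ u v → R u v ≡ R v u) → ∀ {u v} → Reach R u v → Reach R v u
  reach-sym R-sym here               = here
  reach-sym R-sym (step {u} {v} e p) = reach-trans (reach-sym R-sym p) (step (trans (R-sym v u) e) here)

  parity : ∀ {u v} → Reach R u v → Bool
  parity here       = false
  parity (step _ p) = not (parity p)

record Shifts {X : Set} (s : X → Bool) (a : Perm X) (d : Bool) : Set where
  constructor shifting
  field shift : ∀ p → s (to a p) ≡ d xor s p
open Shifts

module _ {X : Set} {s : X → Bool} where

  shifts-∘ : ∀ {a b d e} → Shifts s a d → Shifts s b e → Shifts s (a ∘ₚ b) (d xor e)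
  shift (shifts-∘ {a} {b} {d} {e} a-shifts b-shifts) p = begin
    s (to a (to b p)) ≡⟨ shift a-shifts (to b p) ⟩
    d xor s (to b p)  ≡⟨ cong (d xor_) (shift b-shifts p) ⟩
    d xor (e xor s p) ≡⟨ xor-assoc d e (s p) ⟨
    (d xor e) xor s p ∎
    where open ≡-Reasoning

  shifts-⁻¹ : ∀ {a d} → Shifts s a d → Shifts s (a ⁻¹ₚ) d
  shift (shifts-⁻¹ {a} {d} a-shifts) p = begin
    s (from a p)                     ≡⟨ xor-solve d (s (from a p)) ⟩
    (d xor s (from a p)) xor d       ≡⟨ cong (_xor d) (shift a-shifts (from a p)) ⟨
    s (to a (from a p)) xor d        ≡⟨ cong (λ q → s q xor d) (strictlyInverseˡ a p) ⟩
    s p xor d                        ≡⟨ xor-comm (s p) d ⟩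
    d xor s p                        ∎
    where open ≡-Reasoning

  shifts-conj : ∀ {a b d} → Shifts s a d → Shifts s b false → Shifts s (a ∘ₚ (b ∘ₚ (a ⁻¹ₚ))) false
  shifts-conj {d = d} a-shifts b-preserves =
    subst (Shifts s _) (xor-same d) (shifts-∘ a-shifts (shifts-∘ b-preserves (shifts-⁻¹ a-shifts)))

  module _ {R : Rel₂ X} (edge-flips : ∀ {p q} → R p q ≡ true → s q ≡ not (s p)) where

    aut-shift-invariant : ∀ {a} → IsAut R a → ∀ {p q} → Reach R p q →
                          s p xor s (to a p) ≡ s q xor s (to a q)
    aut-shift-invariant a-aut here = refl
    aut-shift-invariant {a} a-aut (step {p} {q} e r) = begin
      s p xor s (to a p)             ≡⟨ not-xor-not (s p) (s (to a p)) ⟨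
      not (s p) xor not (s (to a p)) ≡⟨ cong₂ _xor_ (edge-flips e) (edge-flips (trans (a-aut p q) e)) ⟨
      s q xor s (to a q)             ≡⟨ aut-shift-invariant {a} a-aut r ⟩
      _                              ∎
      where open ≡-Reasoning

    aut-shifts : Connected R → X → ∀ {a} → IsAut R a → ∃ (Shifts s a)
    aut-shifts connected base {a} a-aut = s base xor s (to a base) , shifting λ p →
      trans (xor-solve (s p) (s (to a p)))
            (cong (_xor s p) (sym (aut-shift-invariant {a} a-aut (connected base p))))

module _ {X : Set} (σ : Perm (X × Bool)) (preserves : Shifts proj₂ σ false) where

  from-layer : ∀ ε x → from σ (x , ε) ≡ (proj₁ (from σ (x , ε)) , ε)
  from-layer ε x = cong (proj₁ (from σ (x , ε)) ,_) (shift (shifts-⁻¹ preserves) (x , ε))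

  to-layer : ∀ ε x → to σ (x , ε) ≡ (proj₁ (to σ (x , ε)) , ε)
  to-layer ε x = cong (proj₁ (to σ (x , ε)) ,_) (shift preserves (x , ε))

  restrictLayer : Bool → Perm X
  restrictLayer ε = mk↔ₛ′ (λ x → proj₁ (to σ (x , ε))) (λ x → proj₁ (from σ (x , ε))) inverseˡ inverseʳ
    where
      inverseˡ : ∀ x → proj₁ (to σ (proj₁ (from σ (x , ε)) , ε)) ≡ x
      inverseˡ x = cong proj₁ (trans (cong (to σ) (sym (from-layer ε x))) (strictlyInverseˡ σ (x , ε)))
      inverseʳ : ∀ x → proj₁ (from σ (proj₁ (to σ (x , ε)) , ε)) ≡ x
      inverseʳ x = cong proj₁ (trans (cong (from σ) (sym (to-layer ε x))) (strictlyInverseʳ σ (x , ε)))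

module _ {n : ℕ} (Γ : Graph n) where

  Dadj-sym : ∀ p q → Dadj Γ p q ≡ Dadj Γ q p
  Dadj-sym (u , x) (v , y) = cong₂ _∧_ (adj-sym Γ u v) (xor-comm x y)

  Dadj-flips : ∀ {p q} → Dadj Γ p q ≡ true → proj₂ q ≡ not (proj₂ p)
  Dadj-flips {u , x} {v , y} e with adj Γ u v
  ... | true = trans (xor-solve x y) (cong (_xor x) e)

  Dadj-across : ∀ ε u v → Dadj Γ (u , not ε) (v , ε) ≡ adj Γ u v
  Dadj-across ε u v = trans (cong (adj Γ u v ∧_) (xor-inverseˡ ε)) (∧-identityʳ _)

  lift-walk : ∀ {u w} (r : Reach (adj Γ) u w) b → Reach (Dadj Γ) (u , b) (w , b xor parity r)
  lift-walk here b = subst (λ c → Reach (Dadj Γ) (_ , b) (_ , c)) (sym (xor-identityʳ b)) here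
  lift-walk (step e r) b =
    step (cong₂ _∧_ e (xor-inverseʳ b))
         (subst (λ c → Reach (Dadj Γ) _ (_ , c)) (trans (sym (not-distribˡ-xor b _)) (not-distribʳ-xor b _))
                (lift-walk r (not b)))

  mkStab : ∀ {σ} → AutD Γ σ → Shifts proj₂ σ false → StabD Γ σ
  mkStab σ-aut preserves = σ-aut , λ p → mk⇔ (trans (shift preserves p)) (trans (sym (shift preserves p)))

  stab-preserves : ∀ {σ} → StabD Γ σ → Shifts proj₂ σ false
  shift (stab-preserves (_ , preserves)) p = ≡false⇔⇒≡ (preserves p)

  Stabiliser : Set
  Stabiliser = Σ (Perm (DV n)) (StabD Γ)

  _·_ : Stabiliser → Stabiliser → Stabiliser
  (σ , st) · (σ' , st') =
    σ ∘ₚ σ' , mkStab {σ ∘ₚ σ'} (aut-∘ {a = σ} {σ'} (proj₁ st) (proj₁ st'))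
                               (shifts-∘ (stab-preserves {σ} st) (stab-preserves {σ'} st'))

  module _ (connected : Connected (adj Γ)) (nonBipartite : ¬ Bipartite (adj Γ)) where

    monochromatic-edge : (c : Fin n → Bool) → ∃₂ λ u v → adj Γ u v ≡ true × c u ≡ c v
    monochromatic-edge c with any? (λ u → any? (λ v → (adj Γ u v Boolₚ.≟ true) ×-dec (c u Boolₚ.≟ c v)))
    ... | yes (u , v , e , same) = u , v , e , same
    ... | no none = ⊥-elim (nonBipartite (c , λ u v e same → none (u , v , e , same)))

    layer-switch : ∀ u → Reach (Dadj Γ) (u , false) (u , true)
    layer-switch u with monochromatic-edge (λ v → parity (connected u v))
    ... | x , y , e , same =
      reach-trans (lift-walk (connected u x) false)
        (step (cong₂ _∧_ e (trans (cong (_xor not cy) same) (xor-inverseʳ cy)))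
              (reach-sym Dadj-sym (lift-walk (connected u y) true)))
      where cy = parity (connected u y)

    layer-change : ∀ u b b' → Reach (Dadj Γ) (u , b) (u , b')
    layer-change u false false = here
    layer-change u false true  = layer-switch u
    layer-change u true  false = reach-sym Dadj-sym (layer-switch u)
    layer-change u true  true  = here

    connected-D : Connected (Dadj Γ)
    connected-D (x , b) (y , b') = reach-trans (lift-walk (connected x y) b) (layer-change y _ b')

    swapLayers : Perm (DV n)
    swapLayers = mk↔ₛ′ swap swap swap-involutive swap-involutive
      where
        swap : DV n → DV n
        swap (v , b) = v , not b
        swap-involutive : ∀ p → swap (swap p) ≡ p
        swap-involutive (v , b) = cong (v ,_) (not-involutive b)

    swapLayers-aut : AutD Γ swapLayers
    swapLayers-aut (u , x) (v , y) = cong (adj Γ u v ∧_) (not-xor-not x y)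

    swapLayers-shifts : Shifts proj₂ swapLayers true
    shift swapLayers-shifts _ = refl

    semidirect : IsSemidirectC₂ (AutD Γ) (StabD Γ)
    semidirect = (λ _ → proj₁) , normal
               , swapLayers , swapLayers-aut , strictlyInverseˡ swapLayers , swap∉B , split
      where
        -- any vertex will do, and a non-bipartite graph has one (an edge, even)
        base : DV n
        base = proj₁ (monochromatic-edge (const false)) , false

        shifts : ∀ {a} → AutD Γ a → ∃ (Shifts proj₂ a)
        shifts = aut-shifts Dadj-flips connected-D base

        normal : ∀ a b → AutD Γ a → StabD Γ b → StabD Γ (a ∘ₚ (b ∘ₚ (a ⁻¹ₚ)))
        normal a b a-aut b-stab =
          mkStab {a ∘ₚ (b ∘ₚ (a ⁻¹ₚ))}
                 (aut-∘ {a = a} {b ∘ₚ (a ⁻¹ₚ)} a-aut (aut-∘ {a = b} {a ⁻¹ₚ} (proj₁ b-stab) (aut-⁻¹ {a = a} a-aut)))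
                 (shifts-conj (proj₂ (shifts {a} a-aut)) (stab-preserves {b} b-stab))

        swap∉B : ¬ StabD Γ swapLayers
        swap∉B st with shift (stab-preserves {swapLayers} st) base
        ... | ()

        split : ∀ a → AutD Γ a → StabD Γ a ⊎ StabD Γ (a ∘ₚ swapLayers)
        split a a-aut with shifts {a} a-aut
        ... | false , a-preserves = inj₁ (mkStab a-aut a-preserves)
        ... | true  , a-swaps     =
          inj₂ (mkStab {a ∘ₚ swapLayers} (aut-∘ {a = a} {swapLayers} a-aut swapLayers-aut)
                                         (shifts-∘ a-swaps swapLayers-shifts))

  restrict : Stabiliser → Bool → Perm (Fin n)
  restrict (σ , st) = restrictLayer σ (stab-preserves st)

  to-restrict : ∀ (b : Stabiliser) ε v → to (proj₁ b) (v , ε) ≡ (to (restrict b ε) v , ε)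
  to-restrict (σ , st) = to-layer σ (stab-preserves st)

  restrict-∘ : ∀ b b' ε → restrict (b · b') ε ≈ₚ (restrict b ε ∘ₚ restrict b' ε)
  restrict-∘ (σ , _) b' ε v = cong (λ p → proj₁ (to σ p)) (to-restrict b' ε v)

  restrict-aut : ∀ b ε ε' u v →
                 Dadj Γ (to (restrict b ε) u , ε) (to (restrict b ε') v , ε') ≡ Dadj Γ (u , ε) (v , ε')
  restrict-aut b ε ε' u v =
    trans (sym (cong₂ (Dadj Γ) (to-restrict b ε u) (to-restrict b ε' v))) (proj₁ (proj₂ b) (u , ε) (v , ε'))

  induced-restrict : ∀ {ε} π b → (∀ v → to (proj₁ b) (v , ε) ≡ (to π v , ε)) → restrict b ε ≈ₚ π
  induced-restrict _ _ eq v = cong proj₁ (eq v)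

  module _ (twinFree : TwinFree (adj Γ)) (b b' : Stabiliser) where

    restrict-other-layer : ∀ ε → restrict b ε ≈ₚ restrict b' ε → restrict b (not ε) ≈ₚ restrict b' (not ε)
    restrict-other-layer ε agree v = twinFree x y λ w →
      let u = from (restrict b ε) w
          bu≡w = strictlyInverseˡ (restrict b ε) w
      in begin
        adj Γ x w                                       ≡⟨ Dadj-across ε x w ⟨
        Dadj Γ (x , not ε) (w , ε)                      ≡⟨ cong (λ z → Dadj Γ (x , not ε) (z , ε)) bu≡w ⟨
        Dadj Γ (x , not ε) (to (restrict b ε) u , ε)    ≡⟨ restrict-aut b (not ε) ε v u ⟩
        Dadj Γ (v , not ε) (u , ε)                      ≡⟨ restrict-aut b' (not ε) ε v u ⟨
        Dadj Γ (y , not ε) (to (restrict b' ε) u , ε)   ≡⟨ cong (λ z → Dadj Γ (y , not ε) (z , ε))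
                                                                (trans (sym (agree u)) bu≡w) ⟩
        Dadj Γ (y , not ε) (w , ε)                      ≡⟨ Dadj-across ε y w ⟩
        adj Γ y w                                       ∎
      where
        open ≡-Reasoning
        x = to (restrict b (not ε)) v
        y = to (restrict b' (not ε)) v

    restrict-all-layers : ∀ ε → restrict b ε ≈ₚ restrict b' ε → ∀ ε' → restrict b ε' ≈ₚ restrict b' ε'
    restrict-all-layers false agree false = agree
    restrict-all-layers false agree true  = restrict-other-layer false agree
    restrict-all-layers true  agree false = restrict-other-layer true agree
    restrict-all-layers true  agree true  = agree

    restrict-injective : ∀ ε → restrict b ε ≈ₚ restrict b' ε → proj₁ b ≈ₚ proj₁ b'
    restrict-injective ε agree (v , ε') = begin
      to (proj₁ b) (v , ε')         ≡⟨ to-restrict b ε' v ⟩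
      (to (restrict b ε') v , ε')   ≡⟨ cong (_, ε') (restrict-all-layers ε agree ε' v) ⟩
      (to (restrict b' ε') v , ε')  ≡⟨ to-restrict b' ε' v ⟨
      to (proj₁ b') (v , ε')        ∎
      where open ≡-Reasoning

  Induced≅StabD : TwinFree (adj Γ) → ∀ ε → Induced Γ ε ≅ StabD Γ
  Induced≅StabD twinFree ε = record
    { f      = λ { (_ , σ , st , _) → σ , st }
    ; f-cong = λ { (π , σ , st , eq) (π' , σ' , st' , eq') π≈π' →
        restrict-injective twinFree (σ , st) (σ' , st') ε λ v →
          trans (induced-restrict π (σ , st) eq v)
                (trans (π≈π' v) (sym (induced-restrict π' (σ' , st') eq' v))) }
    ; f-hom  = λ { (π , σ , st , eq) (π' , σ' , st' , eq') (κ , ρ , sr , er) κ≈ππ' →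
        let b = σ , st ; b' = σ' , st' in
        restrict-injective twinFree (ρ , sr) (b · b') ε λ v → begin
          to (restrict (ρ , sr) ε) v                ≡⟨ induced-restrict κ (ρ , sr) er v ⟩
          to κ v                                    ≡⟨ κ≈ππ' v ⟩
          to π (to π' v)                            ≡⟨ induced-restrict π b eq (to π' v) ⟨
          to (restrict b ε) (to π' v)               ≡⟨ cong (to (restrict b ε)) (induced-restrict π' b' eq' v) ⟨
          to (restrict b ε) (to (restrict b' ε) v)  ≡⟨ restrict-∘ b b' ε v ⟨
          to (restrict (b · b') ε) v                ∎ }
    ; f-inj  = λ { (π , σ , st , eq) (π' , σ' , st' , eq') σ≈σ' v →
        trans (sym (induced-restrict π (σ , st) eq v))
              (trans (cong proj₁ (σ≈σ' (v , ε))) (induced-restrict π' (σ' , st') eq' v)) }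
    ; f-surj = λ { b@(σ , st) → (restrict b ε , σ , st , to-restrict b ε) , λ _ → refl }
    }
    where open ≡-Reasoning

  StabD≅Induced : TwinFree (adj Γ) → ∀ ε → StabD Γ ≅ Induced Γ ε
  StabD≅Induced twinFree ε = record
    { f      = λ { b@(σ , st) → restrict b ε , σ , st , to-restrict b ε }
    ; f-cong = λ { _ _ σ≈σ' v → cong proj₁ (σ≈σ' (v , ε)) }
    ; f-hom  = λ { b b' _ k≈σσ' v → trans (cong proj₁ (k≈σσ' (v , ε))) (restrict-∘ b b' ε v) }
    ; f-inj  = λ { b b' → restrict-injective twinFree b b' ε }
    ; f-surj = λ { (π , σ , st , eq) → (σ , st) , induced-restrict π (σ , st) eq }
    }

lemma2p2 : ∀ {n : ℕ} (Γ : Graph n) →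
    ((Connected (adj Γ) × ¬ Bipartite (adj Γ)) →
      (Connected (Dadj Γ) × IsSemidirectC₂ (AutD Γ) (StabD Γ)))
    × (TwinFree (adj Γ) → (BPlus Γ ≅ StabD Γ) × (StabD Γ ≅ BMinus Γ))
lemma2p2 Γ =
  (λ (connected , nonBipartite) →
     connected-D Γ connected nonBipartite , semidirect Γ connected nonBipartite)
  , λ twinFree → Induced≅StabD Γ twinFree false , StabD≅Induced Γ twinFree true
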